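{- Let $p$ be a prime and let $K\subseteq\mathbb{Q}_p$ be the $p$-adic self-similar set of a finite family of contractions $F_i(x)=\pm p^{k_i}x+b_i$ ($i=1,\dots,n$) with integers $k_i\ge1$ and $b_i\in\mathbb{Z}_p\cap\mathbb{Q}$. Then $K$ is a $p$-adic path set fractal.
   Context: The $p$-adic self-similar set of $\{F_1,\dots,F_n\}$ is the unique non-empty compact $K\subseteq\mathbb{Q}_p$ with $K=\bigcup_iF_i(K)$. A $p$-adic path set fractal is a set of the following form: take a finite directed graph with a distinguished initial vertex, each edge labelled by a digit in $\{0,\dots,p-1\}$; the set is the collection of all $p$-adic integers $\sum_{i\ge0}c_ip^i$ such that $c_0c_1c_2\dots$ is the label sequence of an infinite path starting at the initial vertex. -}

module Defs where

open import Data.Nat as ℕ using (ℕ; zero; suc; _<_; _≤_)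
open import Data.Nat.Divisibility as ℕD using ()
open import Data.Integer as ℤ using (ℤ; +_)
open import Data.Integer.Divisibility as ℤD using ()
open import Data.Rational using (ℚ; ↥_; ↧_; ↧ₙ_)
open import Data.Fin using (Fin; toℕ)
open import Data.Bool using (Bool; true)
open import Data.Product using (Σ; ∃; _×_)
open import Relation.Binary.PropositionalEquality using (_≡_)

-- A p-adic integer, represented by its digit sequence c₀ c₁ c₂ …  (x = Σ cᵢ pⁱ).
ℤ[_] : ℕ → Set
ℤ[ p ] = ℕ → Fin p

res : (p : ℕ) → ℤ[ p ] → ℕ → ℕ
res p x zero    = 0
res p x (suc m) = res p x m ℕ.+ toℕ (x m) ℕ.* (p ℕ.^ m)

_≡_[mod_^_] : ℤ → ℤ → ℕ → ℕ → Set
a ≡ b [mod p ^ m ] = (+ (p ℕ.^ m)) ℤD.∣ (a ℤ.- b)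

data Sign± : Set where
  plus minus : Sign±

applySign : Sign± → ℤ → ℤ
applySign plus  z = z
applySign minus z = ℤ.- z

-- b ∈ ℤ_p ∩ ℚ : a rational whose (reduced) denominator is prime to p
IntegralAt : ℕ → ℚ → Set
IntegralAt p b = (p ℕD.∣ ↧ₙ b) → Data.Empty.⊥
  where import Data.Empty

-- MapsTo p s k b y x  :  x = s·p^k·y + b   in ℤ_p,
-- where b = ↥b/↧b (with ↧b a p-adic unit) is viewed in ℤ_p, i.e.
-- ↧b · x ≡ ↧b · (s·p^k·y) + ↥b  (mod p^m)  for every m.
MapsTo : (p : ℕ) → Sign± → ℕ → ℚ → ℤ[ p ] → ℤ[ p ] → Set
MapsTo p s k b y x = ∀ m →
  (↧ b ℤ.* + res p x m) ≡
  (↧ b ℤ.* applySign s (+ (p ℕ.^ k ℕ.* res p y m)) ℤ.+ ↥ b) [mod p ^ m ]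

Subset : ℕ → Set₁
Subset p = ℤ[ p ] → Set

-- closed (= compact, since ℤ_p is compact) : contains all its limit points
IsClosed : (p : ℕ) → Subset p → Set
IsClosed p K = ∀ x → (∀ m → ∃ λ y → K y × (∀ i → i < m → y i ≡ x i)) → K x

NonEmpty : (p : ℕ) → Subset p → Set
NonEmpty p K = ∃ λ x → K x

IsInvariant : (p n : ℕ) → (Fin n → Sign±) → (Fin n → ℕ) → (Fin n → ℚ) → Subset p → Set
IsInvariant p n s k b K = ∀ x →
  (K x → ∃ λ i → ∃ λ y → K y × MapsTo p (s i) (k i) (b i) y x) ×
  ((∃ λ i → ∃ λ y → K y × MapsTo p (s i) (k i) (b i) y x) → K x)

-- p-adic path set fractal: a finite directed graph on vertices Fin V with edges
-- labelled by digits (E u d v = true iff there is an edge u → v with label d),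
-- an initial vertex v₀, and K = set of x whose digit sequence labels an infinite
-- path starting at v₀.
IsPathSet : (p : ℕ) → Subset p → Set
IsPathSet p K =
  Σ ℕ λ V → Σ (Fin V → Fin p → Fin V → Bool) λ E → Σ (Fin V) λ v₀ →
    ∀ x → (K x → ∃ λ (w : ℕ → Fin V) → w 0 ≡ v₀ × (∀ j → E (w j) (x j) (w (suc j)) ≡ true))
        × ((∃ λ (w : ℕ → Fin V) → w 0 ≡ v₀ × (∀ j → E (w j) (x j) (w (suc j)) ≡ true)) → K x)

-- Let D be the product of the denominators of the bᵢ. A point x ∈ K is followed digit by digit
-- in the form x = σ pʲ y + A/D with y ∈ K. If j > 0, the lowest digit δ of x is forced by
-- A ≡ Dδ (mod p), D being a p-adic unit, and reading it replaces A by (A - Dδ)/p and j by j - 1.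
-- If j = 0, one first writes y = Fᵢ(y′), which adds σ(D/dᵢ)↥bᵢ to A and sets j = kᵢ ≥ 1.
-- The numerators A stay bounded, so the triples (A, σ, j) form a finite graph, and the digits
-- of x label a path from (0, +, 0). Conversely, following a labelled path backwards and applying
-- the Fᵢ gives, for every m, a point of K agreeing with x in its first m digits; K is closed.

module Submission where

open import Defs
open import Data.Bool using (Bool; true)
open import Data.Empty using (⊥-elim)
open import Data.Fin as Fin using (Fin; toℕ)
import Data.Fin.Properties as Fin
open import Data.Integer as ℤ using (ℤ; +_; -[1+_]; _+_; _*_; _-_; -_; ∣_∣; 0ℤ; 1ℤ; -1ℤ)
import Data.Integer.Properties as ℤ
open import Data.Integer.Divisibility.Signed
  using (_∣_; divides; ∣-refl; ∣-trans; ∣ᵤ⇒∣; ∣⇒∣ᵤ; ∣m⇒∣m*n; ∣n⇒∣m*n; ∣m∣n⇒∣m+n; ∣m∣n⇒∣m-n; ∣m+n∣n⇒∣m;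
         ∣m⇒∣-m; *-monoʳ-∣; *-cancelˡ-∣)
open import Data.Integer.DivMod using (_/ℕ_; _%ℕ_; n%ℕd<d; a≡a%ℕn+[a/ℕn]*n)
open import Data.Integer.Tactic.RingSolver using (solve-∀)
open import Data.Nat as ℕ using (ℕ; zero; suc; z≤n; s≤s; _≤_; _<_; NonZero; nonTrivial⇒n>1)
import Data.Nat.Properties as ℕ
import Data.Nat.Divisibility as ℕ
import Data.Nat.Tactic.RingSolver as ℕ-Solver
open import Data.Nat.Coprimality using (Coprime; coprime-Bézout; coprime-divisor)
open import Data.Nat.GCD using (module Bézout)
open import Data.Nat.Primality
  using (Prime; prime⇒nonZero; prime⇒nonTrivial; prime⇒irreducible; ¬prime[1]; euclidsLemma)
open import Data.Product using (Σ; ∃; _×_; _,_; proj₁; proj₂; map; map₁)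
open import Data.Rational using (ℚ; ↥_; ↧ₙ_)
open import Data.Sum using (inj₁; inj₂)
open import Function using (_⇔_; mk⇔; Equivalence)
open import Relation.Binary.Definitions using (DecidableEquality)
open import Relation.Binary.PropositionalEquality
open import Relation.Nullary using (¬_; Dec; does; yes; no)
open import Relation.Nullary.Decidable using (_×-dec_; dec-true)

∣-⇒≡+* : ∀ {P A B} → P ∣ A - B → ∃ λ A′ → A ≡ B + P * A′
∣-⇒≡+* {P} {A} {B} (divides q eq) = q , (begin
  A             ≡⟨ shape A B ⟩
  B + (A - B)   ≡⟨ cong (_+_ B) (trans eq (ℤ.*-comm q P)) ⟩
  B + P * q     ∎)
  where
  open ≡-Reasoning
  shape : ∀ A B → A ≡ B + (A - B)
  shape = solve-∀

∣-∧<⇒≡ : ∀ {a b n} → a < n → b < n → + n ∣ + a - + b → a ≡ b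
∣-∧<⇒≡ {a} {b} {n} a<n b<n n∣a-b with ∣ a ℤ.⊖ b ∣ in ∣a⊖b∣≡
... | zero  = ℤ.+-injective (ℤ.i-j≡0⇒i≡j (+ a) (+ b) (trans (ℤ.m-n≡m⊖n a b) (ℤ.∣i∣≡0⇒i≡0 ∣a⊖b∣≡)))
... | suc r = ⊥-elim (ℕ.<⇒≱ (ℕ.≤-<-trans ∣a⊖b∣≤ (ℕ.⊔-lub a<n b<n)) (ℕ.∣⇒≤ n∣suc-r))
  where
  n∣suc-r : n ℕ.∣ suc r
  n∣suc-r = subst (n ℕ.∣_) (trans (cong ∣_∣ (ℤ.m-n≡m⊖n a b)) ∣a⊖b∣≡) (∣⇒∣ᵤ n∣a-b)
  ∣a⊖b∣≤ : suc r ≤ a ℕ.⊔ b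
  ∣a⊖b∣≤ = subst (_≤ a ℕ.⊔ b) ∣a⊖b∣≡ (ℤ.∣m⊝n∣≤m⊔n a b)

prime∤⇒coprime : ∀ {p n} → Prime p → ¬ p ℕ.∣ n → Coprime p n
prime∤⇒coprime p-prime p∤n (i∣p , i∣n) with prime⇒irreducible p-prime i∣p
... | inj₁ i≡1  = i≡1
... | inj₂ refl = ⊥-elim (p∤n i∣n)

∏ : ∀ {n} → (Fin n → ℕ) → ℕ
∏ {zero}  f = 1
∏ {suc n} f = f Fin.zero ℕ.* ∏ (λ i → f (Fin.suc i))

∑ : ∀ {n} → (Fin n → ℕ) → ℕ
∑ {zero}  f = 0
∑ {suc n} f = f Fin.zero ℕ.+ ∑ (λ i → f (Fin.suc i))

∣∏ : ∀ {n} (f : Fin n → ℕ) i → f i ℕ.∣ ∏ f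
∣∏ f Fin.zero    = ℕ.m∣m*n _
∣∏ f (Fin.suc i) = ℕ.∣-trans (∣∏ (λ i → f (Fin.suc i)) i) (ℕ.n∣m*n (f Fin.zero))

≤∑ : ∀ {n} (f : Fin n → ℕ) i → f i ≤ ∑ f
≤∑ f Fin.zero    = ℕ.m≤m+n _ _
≤∑ f (Fin.suc i) = ℕ.≤-trans (≤∑ (λ i → f (Fin.suc i)) i) (ℕ.m≤n+m _ _)

prime∤∏ : ∀ {p n} (f : Fin n → ℕ) → Prime p → (∀ i → ¬ p ℕ.∣ f i) → ¬ p ℕ.∣ ∏ f
prime∤∏ {n = zero}  f p-prime _ p∣1 = ¬prime[1] (subst Prime (ℕ.∣1⇒≡1 p∣1) p-prime)
prime∤∏ {n = suc n} f p-prime p∤f p∣∏ with euclidsLemma (f Fin.zero) _ p-prime p∣∏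
... | inj₁ p∣f₀ = p∤f Fin.zero p∣f₀
... | inj₂ p∣∏′ = prime∤∏ (λ i → f (Fin.suc i)) p-prime (λ i → p∤f (Fin.suc i)) p∣∏′

quotient-bound : ∀ {p Dₙ E δ B A′} → 2 ≤ p → δ < p →
  B ≡ + Dₙ * + δ + + p * A′ → ∣ B ∣ ≤ Dₙ ℕ.+ E ℕ.+ E → ∣ A′ ∣ ≤ Dₙ ℕ.+ E
quotient-bound {suc zero} (s≤s ()) _ _ _
quotient-bound {suc (suc q)} {Dₙ} {E} {δ} {B} {A′} _ (s≤s δ≤1+q) B≡ B≤ = ℕ.*-cancelˡ-≤ (suc (suc q)) (begin
  suc (suc q) ℕ.* ∣ A′ ∣                   ≡⟨ ℤ.abs-* (+ suc (suc q)) A′ ⟨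
  ∣ + suc (suc q) * A′ ∣                   ≡⟨ cong ∣_∣ (solve-for-A′ B≡) ⟩
  ∣ B - + Dₙ * + δ ∣                       ≤⟨ ℤ.∣i-j∣≤∣i∣+∣j∣ B (+ Dₙ * + δ) ⟩
  ∣ B ∣ ℕ.+ ∣ + Dₙ * + δ ∣                 ≤⟨ ℕ.+-mono-≤ B≤ (ℕ.≤-reflexive (ℤ.abs-* (+ Dₙ) (+ δ))) ⟩
  Dₙ ℕ.+ E ℕ.+ E ℕ.+ Dₙ ℕ.* δ              ≤⟨ ℕ.+-monoʳ-≤ (Dₙ ℕ.+ E ℕ.+ E) (ℕ.*-monoʳ-≤ Dₙ δ≤1+q) ⟩
  Dₙ ℕ.+ E ℕ.+ E ℕ.+ Dₙ ℕ.* suc q          ≡⟨ shape Dₙ E q ⟩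
  Dₙ ℕ.+ E ℕ.+ (Dₙ ℕ.+ E ℕ.+ q ℕ.* Dₙ)     ≤⟨ ℕ.+-monoʳ-≤ (Dₙ ℕ.+ E) (ℕ.+-monoʳ-≤ (Dₙ ℕ.+ E) (ℕ.*-monoʳ-≤ q (ℕ.m≤m+n Dₙ E))) ⟩
  suc (suc q) ℕ.* (Dₙ ℕ.+ E)               ∎)
  where
  open ℕ.≤-Reasoning
  solve-for-A′ : ∀ {B x y} → B ≡ x + y → y ≡ B - x
  solve-for-A′ {x = x} {y} refl = shape′ x y
    where
    shape′ : ∀ x y → y ≡ x + y - x
    shape′ = solve-∀
  shape : ∀ Dₙ E q → Dₙ ℕ.+ E ℕ.+ E ℕ.+ Dₙ ℕ.* suc q ≡ Dₙ ℕ.+ E ℕ.+ (Dₙ ℕ.+ E ℕ.+ q ℕ.* Dₙ)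
  shape = ℕ-Solver.solve-∀

does≡true⇒ : ∀ {A : Set} (a? : Dec A) → does a? ≡ true → A
does≡true⇒ (yes a) _ = a

sign : Sign± → ℤ
sign plus  = 1ℤ
sign minus = -1ℤ

applySign≡sign* : ∀ σ z → applySign σ z ≡ sign σ * z
applySign≡sign* plus  z = sym (ℤ.*-identityˡ z)
applySign≡sign* minus z = sym (ℤ.-1*i≡-i z)

_*ˢ_ : Sign± → Sign± → Sign±
σ     *ˢ plus  = σ
plus  *ˢ minus = minus
minus *ˢ minus = plus

sign-*ˢ : ∀ σ τ → sign (σ *ˢ τ) ≡ sign σ * sign τ
sign-*ˢ σ     plus  = sym (ℤ.*-identityʳ (sign σ))
sign-*ˢ plus  minus = refl
sign-*ˢ minus minus = refl

∣sign∣≡1 : ∀ σ → ∣ sign σ ∣ ≡ 1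
∣sign∣≡1 plus  = refl
∣sign∣≡1 minus = refl

_≟ˢ_ : DecidableEquality Sign±
plus  ≟ˢ plus  = yes refl
plus  ≟ˢ minus = no λ ()
minus ≟ˢ plus  = no λ ()
minus ≟ˢ minus = yes refl

signOf : ℤ → Sign±
signOf (+ _)    = plus
signOf -[1+ _ ] = minus

applySign-signOf : ∀ A → applySign (signOf A) (+ ∣ A ∣) ≡ A
applySign-signOf (+ _)    = refl
applySign-signOf -[1+ _ ] = refl

State : Set
State = ℤ × Sign± × ℕ

module _ {p : ℕ} where

  tail : ℤ[ p ] → ℤ[ p ]
  tail x i = x (suc i)

  res-suc : ∀ x m → res p x (suc m) ≡ toℕ (x 0) ℕ.+ p ℕ.* res p (tail x) m
  res-suc x zero    = shape (toℕ (x 0)) p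
    where
    shape : ∀ a b → a ℕ.* 1 ≡ a ℕ.+ b ℕ.* 0
    shape = ℕ-Solver.solve-∀
  res-suc x (suc m) = begin
    res p x (suc m) ℕ.+ toℕ (x (suc m)) ℕ.* (p ℕ.* p ℕ.^ m)
      ≡⟨ cong (ℕ._+ toℕ (x (suc m)) ℕ.* (p ℕ.* p ℕ.^ m)) (res-suc x m) ⟩
    toℕ (x 0) ℕ.+ p ℕ.* res p (tail x) m ℕ.+ toℕ (x (suc m)) ℕ.* (p ℕ.* p ℕ.^ m)
      ≡⟨ shape (toℕ (x 0)) p (res p (tail x) m) (toℕ (x (suc m))) (p ℕ.^ m) ⟩
    toℕ (x 0) ℕ.+ p ℕ.* (res p (tail x) m ℕ.+ toℕ (x (suc m)) ℕ.* p ℕ.^ m) ∎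
    where
    open ≡-Reasoning
    shape : ∀ a b c d e → a ℕ.+ b ℕ.* c ℕ.+ d ℕ.* (b ℕ.* e) ≡ a ℕ.+ b ℕ.* (c ℕ.+ d ℕ.* e)
    shape = ℕ-Solver.solve-∀

  res<p^m : ∀ x m → res p x m < p ℕ.^ m
  res<p^m x zero    = s≤s z≤n
  res<p^m x (suc m) = begin-strict
    res p x m ℕ.+ toℕ (x m) ℕ.* p ℕ.^ m <⟨ ℕ.+-monoˡ-< _ (res<p^m x m) ⟩
    p ℕ.^ m ℕ.+ toℕ (x m) ℕ.* p ℕ.^ m   ≤⟨ ℕ.*-monoˡ-≤ (p ℕ.^ m) (Fin.toℕ<n (x m)) ⟩
    p ℕ.* p ℕ.^ m                       ∎
    where open ℕ.≤-Reasoning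

  res≡⇒digit≡ : ∀ {{_ : NonZero p}} (x z : ℤ[ p ]) i →
    res p x i ≡ res p z i → res p x (suc i) ≡ res p z (suc i) → x i ≡ z i
  res≡⇒digit≡ x z i eqᵢ eqₛᵢ = Fin.toℕ-injective (ℕ.*-cancelʳ-≡ _ _ (p ℕ.^ i) {{ℕ.m^n≢0 p i}}
    (ℕ.+-cancelˡ-≡ (res p x i) _ _ (trans eqₛᵢ (cong (ℕ._+ toℕ (z i) ℕ.* p ℕ.^ i) (sym eqᵢ)))))

  pow : ℕ → ℤ
  pow j = + (p ℕ.^ j)

  resℤ : ℤ[ p ] → ℕ → ℤ
  resℤ x m = + res p x m

  digit : ℤ[ p ] → ℕ → ℤ
  digit x i = + toℕ (x i)

  resℤ-suc : ∀ x m → resℤ x (suc m) ≡ digit x 0 + + p * resℤ (tail x) m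
  resℤ-suc x m = begin
    + res p x (suc m)                                 ≡⟨ cong +_ (res-suc x m) ⟩
    + (toℕ (x 0) ℕ.+ p ℕ.* res p (tail x) m)          ≡⟨ ℤ.pos-+ (toℕ (x 0)) _ ⟩
    digit x 0 + + (p ℕ.* res p (tail x) m)            ≡⟨ cong (_+_ (digit x 0)) (ℤ.pos-* p _) ⟩
    digit x 0 + + p * resℤ (tail x) m                 ∎
    where open ≡-Reasoning

  resℤ-step : ∀ x m → resℤ x (suc m) ≡ resℤ x m + digit x m * pow m
  resℤ-step x m = trans (ℤ.pos-+ (res p x m) _) (cong (_+_ (resℤ x m)) (ℤ.pos-* (toℕ (x m)) _))

  -- (A , σ , j) codes the map y ↦ σ pʲ y + A/D, and Affine D v x y m says that x is
  -- the image of y to precision pᵐ; for D = ↧ b, A = ↥ b this is exactly MapsTo.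
  defect : ℤ → State → ℤ[ p ] → ℤ[ p ] → ℕ → ℤ
  defect D (A , σ , j) x y m = D * resℤ x m - (D * applySign σ (+ (p ℕ.^ j ℕ.* res p y m)) + A)

  Affine : ℤ → State → ℤ[ p ] → ℤ[ p ] → ℕ → Set
  Affine D v x y m = pow m ∣ defect D v x y m

  defect-normal : ∀ D A σ j x y m →
    defect D (A , σ , j) x y m ≡ D * resℤ x m - (D * (sign σ * (pow j * resℤ y m)) + A)
  defect-normal D A σ j x y m = cong (λ t → D * resℤ x m - (D * t + A))
    (trans (applySign≡sign* σ _) (cong (sign σ *_) (ℤ.pos-* (p ℕ.^ j) (res p y m))))

  affine-zero : ∀ D v x y → Affine D v x y 0
  affine-zero D v x y = divides (defect D v x y 0) (sym (ℤ.*-identityʳ _))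

  affine-refl : ∀ D x m → Affine D (0ℤ , plus , 0) x x m
  affine-refl D x m = divides 0ℤ (trans (defect-normal D 0ℤ plus 0 x x m) (shape D (resℤ x m)))
    where
    shape : ∀ D X → D * X - (D * (1ℤ * (1ℤ * X)) + 0ℤ) ≡ 0ℤ
    shape = solve-∀

  affine-pred : ∀ D v x y m → Affine D v x y (suc m) → Affine D v x y m
  affine-pred D (A , σ , j) x y m h = ∣m+n∣n⇒∣m (∣-trans (∣n⇒∣m*n (+ p) ∣-refl) h′) (∣m⇒∣m*n _ ∣-refl)
    where
    open ≡-Reasoning
    X = resℤ x m
    Y = resℤ y m
    xₘ = digit x m
    yₘ = digit y m
    shape : ∀ D X xₘ Pₘ s Pⱼ Y yₘ A →
      D * (X + xₘ * Pₘ) - (D * (s * (Pⱼ * (Y + yₘ * Pₘ))) + A)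
        ≡ D * X - (D * (s * (Pⱼ * Y)) + A) + Pₘ * (D * xₘ - D * (s * (Pⱼ * yₘ)))
    shape = solve-∀
    c = D * xₘ - D * (sign σ * (pow j * yₘ))
    h′ : + p * pow m ∣ defect D (A , σ , j) x y m + pow m * c
    h′ = subst₂ _∣_ (ℤ.pos-* p (p ℕ.^ m)) (begin
      defect D (A , σ , j) x y (suc m)
        ≡⟨ defect-normal D A σ j x y (suc m) ⟩
      D * resℤ x (suc m) - (D * (sign σ * (pow j * resℤ y (suc m))) + A)
        ≡⟨ cong₂ (λ a b → D * a - (D * (sign σ * (pow j * b)) + A)) (resℤ-step x m) (resℤ-step y m) ⟩
      D * (X + xₘ * pow m) - (D * (sign σ * (pow j * (Y + yₘ * pow m))) + A)
        ≡⟨ shape D X xₘ (pow m) (sign σ) (pow j) Y yₘ A ⟩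
      D * X - (D * (sign σ * (pow j * Y)) + A) + pow m * c
        ≡⟨ cong (_+ pow m * c) (sym (defect-normal D A σ j x y m)) ⟩
      defect D (A , σ , j) x y m + pow m * c ∎) h

  affine-≤ : ∀ D v x y {m m′} → m′ ≤ m → Affine D v x y m → Affine D v x y m′
  affine-≤ D v x y m′≤m = go (ℕ.≤⇒≤′ m′≤m)
    where
    go : ∀ {m m′} → m′ ℕ.≤′ m → Affine D v x y m → Affine D v x y m′
    go ℕ.≤′-refl             h = h
    go (ℕ.≤′-step {m} m′≤m) h = go m′≤m (affine-pred D v x y m h)

  Digit : ℤ → State → Fin p → State → Set
  Digit D (A , σ , j) δ (A′ , σ′ , j′) = A ≡ D * + toℕ δ + + p * A′ × σ′ ≡ σ × j ≡ suc j′

  Digit? : ∀ D v δ v′ → Dec (Digit D v δ v′)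
  Digit? D (A , σ , j) δ (A′ , σ′ , j′) = (A ℤ.≟ _) ×-dec (σ′ ≟ˢ σ) ×-dec (j ℕ.≟ suc j′)

  affine-digit : ∀ {{_ : NonZero p}} D v v′ x y m → Digit D v (x 0) v′ →
    Affine D v x y (suc m) ⇔ Affine D v′ (tail x) y m
  affine-digit D (A , σ , suc j) (A′ , σ , j) x y m (A≡ , refl , refl) = mk⇔ peel unpeel
    where
    open ≡-Reasoning
    P = + p
    d′ = defect D (A′ , σ , j) (tail x) y m
    X′ = resℤ (tail x) m
    Y = resℤ y m
    c = D * sign σ * pow j * digit y m
    pow-suc : pow (suc m) ≡ P * pow m
    pow-suc = ℤ.pos-* p (p ℕ.^ m)
    carry : pow (suc m) ∣ pow (suc m) * c
    carry = ∣m⇒∣m*n c ∣-refl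
    shape : ∀ D x₀ X′ P Pⱼ Pₘ Y yₘ s A′ →
      D * (x₀ + P * X′) - (D * (s * ((P * Pⱼ) * (Y + yₘ * Pₘ))) + (D * x₀ + P * A′))
        ≡ P * (D * X′ - (D * (s * (Pⱼ * Y)) + A′)) - (P * Pₘ) * (D * s * Pⱼ * yₘ)
    shape = solve-∀
    split : defect D (A , σ , suc j) x y (suc m) ≡ P * defect D (A′ , σ , j) (tail x) y m - pow (suc m) * c
    split = begin
      defect D (A , σ , suc j) x y (suc m)
        ≡⟨ defect-normal D A σ (suc j) x y (suc m) ⟩
      D * resℤ x (suc m) - (D * (sign σ * (pow (suc j) * resℤ y (suc m))) + A)
        ≡⟨ cong₂ (λ a b → D * a - (D * (sign σ * b) + A)) (resℤ-suc x m)
             (cong₂ _*_ (ℤ.pos-* p (p ℕ.^ j)) (resℤ-step y m)) ⟩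
      D * (digit x 0 + P * X′) - (D * (sign σ * ((P * pow j) * (Y + digit y m * pow m))) + A)
        ≡⟨ cong (λ a → D * (digit x 0 + P * X′) - (D * (sign σ * ((P * pow j) * (Y + digit y m * pow m))) + a)) A≡ ⟩
      D * (digit x 0 + P * X′) - (D * (sign σ * ((P * pow j) * (Y + digit y m * pow m))) + (D * digit x 0 + P * A′))
        ≡⟨ shape D (digit x 0) X′ P (pow j) (pow m) Y (digit y m) (sign σ) A′ ⟩
      P * (D * X′ - (D * (sign σ * (pow j * Y)) + A′)) - (P * pow m) * c
        ≡⟨ cong₂ (λ a b → P * a - b * c) (sym (defect-normal D A′ σ j (tail x) y m)) (sym pow-suc) ⟩
      P * defect D (A′ , σ , j) (tail x) y m - pow (suc m) * c ∎
    peel : Affine D (A , σ , suc j) x y (suc m) → Affine D (A′ , σ , j) (tail x) y m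
    peel h = *-cancelˡ-∣ P (subst (_∣ P * d′) pow-suc
      (∣m+n∣n⇒∣m {m = P * d′} (subst (pow (suc m) ∣_) split h) (∣m⇒∣-m carry)))
    unpeel : Affine D (A′ , σ , j) (tail x) y m → Affine D (A , σ , suc j) x y (suc m)
    unpeel h = subst (pow (suc m) ∣_) (sym split)
      (∣m∣n⇒∣m-n (subst (_∣ P * d′) (sym pow-suc) (*-monoʳ-∣ P h)) carry)

  affine-first-digit : ∀ D A σ j x y → Affine D (A , σ , suc j) x y 1 → ∃ λ A′ → A ≡ D * digit x 0 + + p * A′
  affine-first-digit D A σ j x y h = ∣-⇒≡+* (subst (P ∣_) (sym split)
    (∣m∣n⇒∣m-n (∣m⇒∣-m (subst (_∣ defect D (A , σ , suc j) x y 1) (cong +_ (ℕ.*-identityʳ p)) h))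
               (∣m⇒∣m*n _ ∣-refl)))
    where
    open ≡-Reasoning
    P = + p
    Y = resℤ y 1
    shape : ∀ D x₀ P s Pⱼ Y A →
      A - D * x₀ ≡ - (D * (x₀ + P * 0ℤ) - (D * (s * ((P * Pⱼ) * Y)) + A)) - P * (D * (s * (Pⱼ * Y)))
    shape = solve-∀
    split : A - D * digit x 0 ≡ - defect D (A , σ , suc j) x y 1 - P * (D * (sign σ * (pow j * Y)))
    split = begin
      A - D * digit x 0
        ≡⟨ shape D (digit x 0) P (sign σ) (pow j) Y A ⟩
      - (D * (digit x 0 + P * 0ℤ) - (D * (sign σ * ((P * pow j) * Y)) + A)) - P * (D * (sign σ * (pow j * Y)))
        ≡⟨ cong₂ (λ a b → - (D * a - (D * (sign σ * (b * Y)) + A)) - P * (D * (sign σ * (pow j * Y))))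
             (sym (resℤ-suc x 0)) (sym (ℤ.pos-* p (p ℕ.^ j))) ⟩
      - (D * resℤ x 1 - (D * (sign σ * (pow (suc j) * Y)) + A)) - P * (D * (sign σ * (pow j * Y)))
        ≡⟨ cong (λ a → - a - P * (D * (sign σ * (pow j * Y)))) (sym (defect-normal D A σ (suc j) x y 1)) ⟩
      - defect D (A , σ , suc j) x y 1 - P * (D * (sign σ * (pow j * Y))) ∎

  affine-compose : ∀ {D} c d A σ u s k x y y′ m → D ≡ c * d → Affine d (u , s , k) y y′ m →
    Affine D (A , σ , 0) x y m ⇔ Affine D (A + sign σ * (c * u) , σ *ˢ s , k) x y′ m
  affine-compose c d A σ u s k x y y′ m refl hy = mk⇔
    (λ h → subst (pow m ∣_) (sym split) (∣m∣n⇒∣m+n h (∣n⇒∣m*n (sign σ * c) hy)))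
    (λ h → ∣m+n∣n⇒∣m {m = defect (c * d) (A , σ , 0) x y m} (subst (pow m ∣_) split h) (∣n⇒∣m*n (sign σ * c) hy))
    where
    open ≡-Reasoning
    X = resℤ x m
    Y = resℤ y m
    Y′ = resℤ y′ m
    shape : ∀ c d X sσ sₛ Pₖ Y′ A u Y →
      c * d * X - (c * d * ((sσ * sₛ) * (Pₖ * Y′)) + (A + sσ * (c * u)))
        ≡ c * d * X - (c * d * (sσ * (1ℤ * Y)) + A) + sσ * c * (d * Y - (d * (sₛ * (Pₖ * Y′)) + u))
    shape = solve-∀
    split : defect (c * d) (A + sign σ * (c * u) , σ *ˢ s , k) x y′ m
              ≡ defect (c * d) (A , σ , 0) x y m + sign σ * c * defect d (u , s , k) y y′ m
    split = begin
      defect (c * d) (A + sign σ * (c * u) , σ *ˢ s , k) x y′ m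
        ≡⟨ defect-normal (c * d) _ (σ *ˢ s) k x y′ m ⟩
      c * d * X - (c * d * (sign (σ *ˢ s) * (pow k * Y′)) + (A + sign σ * (c * u)))
        ≡⟨ cong (λ a → c * d * X - (c * d * (a * (pow k * Y′)) + (A + sign σ * (c * u)))) (sign-*ˢ σ s) ⟩
      c * d * X - (c * d * ((sign σ * sign s) * (pow k * Y′)) + (A + sign σ * (c * u)))
        ≡⟨ shape c d X (sign σ) (sign s) (pow k) Y′ A u Y ⟩
      c * d * X - (c * d * (sign σ * (1ℤ * Y)) + A) + sign σ * c * (d * Y - (d * (sign s * (pow k * Y′)) + u))
        ≡⟨ sym (cong₂ (λ a b → a + sign σ * c * b) (defect-normal (c * d) A σ 0 x y m) (defect-normal d u s k y y′ m)) ⟩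
      defect (c * d) (A , σ , 0) x y m + sign σ * c * defect d (u , s , k) y y′ m ∎

  affine-tail : ∀ y m → Affine 1ℤ (digit y 0 , plus , 1) y (tail y) m
  affine-tail y zero    = affine-zero 1ℤ (digit y 0 , plus , 1) y (tail y)
  affine-tail y (suc m) = divides (- digit (tail y) m) (begin
    defect 1ℤ (y₀ , plus , 1) y (tail y) (suc m)
      ≡⟨ defect-normal 1ℤ y₀ plus 1 y (tail y) (suc m) ⟩
    1ℤ * resℤ y (suc m) - (1ℤ * (1ℤ * (pow 1 * resℤ (tail y) (suc m))) + y₀)
      ≡⟨ cong₂ (λ a b → 1ℤ * a - (1ℤ * (1ℤ * b) + y₀))
           (resℤ-suc y m) (cong₂ _*_ (cong +_ (ℕ.*-identityʳ p)) (resℤ-step (tail y) m)) ⟩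
    1ℤ * (y₀ + P * T) - (1ℤ * (1ℤ * (P * (T + t * pow m))) + y₀)
      ≡⟨ shape y₀ P T t (pow m) ⟩
    - t * (P * pow m)
      ≡⟨ cong (- t *_) (sym (ℤ.pos-* p (p ℕ.^ m))) ⟩
    - t * pow (suc m) ∎)
    where
    open ≡-Reasoning
    P = + p
    y₀ = digit y 0
    T = resℤ (tail y) m
    t = digit (tail y) m
    shape : ∀ y₀ P T t Pₘ → 1ℤ * (y₀ + P * T) - (1ℤ * (1ℤ * (P * (T + t * Pₘ))) + y₀) ≡ - t * (P * Pₘ)
    shape = solve-∀

module _ {p : ℕ} {{_ : NonZero p}} {D : ℕ} (p⊥D : Coprime p D) where

  inverse-mod-p : ∃ λ t → ∃ λ q → + D * t ≡ 1ℤ + + p * q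
  inverse-mod-p with coprime-Bézout p⊥D
  ... | Bézout.-+ x y eq = + y , + x , (begin
    + D * + y            ≡⟨ sym (ℤ.pos-* D y) ⟩
    + (D ℕ.* y)          ≡⟨ cong +_ (trans (ℕ.*-comm D y) (sym eq)) ⟩
    + (1 ℕ.+ x ℕ.* p)    ≡⟨ cong (_+_ 1ℤ) (trans (ℤ.pos-* x p) (ℤ.*-comm (+ x) (+ p))) ⟩
    1ℤ + + p * + x       ∎)
    where open ≡-Reasoning
  ... | Bézout.+- x y eq = - + y , - + x , (begin
    + D * - + y                  ≡⟨ shape (+ D) (+ y) ⟩
    1ℤ - (1ℤ + + y * + D)        ≡⟨ cong (_-_ 1ℤ) eqℤ ⟩
    1ℤ - + x * + p               ≡⟨ shape′ (+ x) (+ p) ⟩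
    1ℤ + + p * - + x             ∎)
    where
    open ≡-Reasoning
    eqℤ : 1ℤ + + y * + D ≡ + x * + p
    eqℤ = trans (cong (_+_ 1ℤ) (sym (ℤ.pos-* y D))) (trans (cong +_ eq) (ℤ.pos-* x p))
    shape : ∀ D y → D * - y ≡ 1ℤ - (1ℤ + y * D)
    shape = solve-∀
    shape′ : ∀ x P → 1ℤ - x * P ≡ 1ℤ + P * - x
    shape′ = solve-∀

  digit-split : ∀ A → Σ (Fin p) λ δ → Σ ℤ λ A′ → A ≡ + D * + toℕ δ + + p * A′
  digit-split A = Fin.fromℕ< (n%ℕd<d (A * t) p) , + D * r - A * q , sym (begin
    + D * + toℕ (Fin.fromℕ< (n%ℕd<d (A * t) p)) + P * (+ D * r - A * q)
      ≡⟨ cong (λ a → + D * + a + P * (+ D * r - A * q)) (Fin.toℕ-fromℕ< (n%ℕd<d (A * t) p)) ⟩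
    + D * + ((A * t) %ℕ p) + P * (+ D * r - A * q)
      ≡⟨ shape (+ D) (+ ((A * t) %ℕ p)) r P A q ⟩
    + D * (+ ((A * t) %ℕ p) + r * P) - A * (P * q)
      ≡⟨ cong (λ a → + D * a - A * (P * q)) (sym (a≡a%ℕn+[a/ℕn]*n (A * t) p)) ⟩
    + D * (A * t) - A * (P * q)
      ≡⟨ cong (_- A * (P * q)) (shape′ (+ D) A t) ⟩
    A * (+ D * t) - A * (P * q)
      ≡⟨ cong (λ a → A * a - A * (P * q)) (proj₂ (proj₂ inverse-mod-p)) ⟩
    A * (1ℤ + P * q) - A * (P * q)
      ≡⟨ shape″ A (P * q) ⟩
    A ∎)
    where
    open ≡-Reasoning
    P = + p
    t = proj₁ inverse-mod-p
    q = proj₁ (proj₂ inverse-mod-p)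
    r = (A * t) /ℕ p
    shape : ∀ D δ r P A q → D * δ + P * (D * r - A * q) ≡ D * (δ + r * P) - A * (P * q)
    shape = solve-∀
    shape′ : ∀ D A t → D * (A * t) ≡ A * (D * t)
    shape′ = solve-∀
    shape″ : ∀ A c → A * (1ℤ + c) - A * c ≡ A
    shape″ = solve-∀

  lowDigit : ℤ → Fin p
  lowDigit A = proj₁ (digit-split A)

  highPart : ℤ → ℤ
  highPart A = proj₁ (proj₂ (digit-split A))

  -- At exponent 0, y = y₀ + p·(tail y) turns (A , σ , 0) into (A + σDy₀ , σ , 1) applied to tail y.
  image : State → ℤ[ p ] → ℤ[ p ]
  image (A , σ , suc j) y zero    = lowDigit A
  image (A , σ , suc j) y (suc i) = image (highPart A , σ , j) y i
  image (A , σ , zero)  y zero    = lowDigit (A + sign σ * (+ D * digit y 0))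
  image (A , σ , zero)  y (suc i) = image (highPart (A + sign σ * (+ D * digit y 0)) , σ , 0) (tail y) i

  image-affine : ∀ v y m → Affine (+ D) v (image v y) y m
  image-affine v y zero = affine-zero (+ D) v (image v y) y
  image-affine (A , σ , suc j) y (suc m) =
    Equivalence.from (affine-digit (+ D) _ (highPart A , σ , j) (image (A , σ , suc j) y) y m
      (proj₂ (proj₂ (digit-split A)) , refl , refl))
    (image-affine (highPart A , σ , j) y m)
  image-affine (A , σ , zero) y (suc m) =
    Equivalence.from (affine-compose (+ D) 1ℤ A σ (digit y 0) plus 1 x y (tail y) (suc m)
      (sym (ℤ.*-identityʳ (+ D))) (affine-tail y (suc m)))
    (Equivalence.from (affine-digit (+ D) (B , σ , 1) (highPart B , σ , 0) x (tail y) m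
      (proj₂ (proj₂ (digit-split B)) , refl , refl))
    (image-affine (highPart B , σ , 0) (tail y) m))
    where
    x = image (A , σ , zero) y
    B = A + sign σ * (+ D * digit y 0)

  p^m∣D*n⇒p^m∣n : ∀ m n → p ℕ.^ m ℕ.∣ D ℕ.* n → p ℕ.^ m ℕ.∣ n
  p^m∣D*n⇒p^m∣n zero    n _ = ℕ.1∣ n
  p^m∣D*n⇒p^m∣n (suc m) n p^m+1∣Dn with coprime-divisor p⊥D (ℕ.∣-trans (ℕ.m∣m*n (p ℕ.^ m)) p^m+1∣Dn)
  ... | ℕ.divides k refl = subst (ℕ._∣ k ℕ.* p) (ℕ.*-comm (p ℕ.^ m) p) (ℕ.*-monoˡ-∣ p p^m∣k)
    where
    p^m∣k : p ℕ.^ m ℕ.∣ k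
    p^m∣k = p^m∣D*n⇒p^m∣n m k
      (ℕ.*-cancelʳ-∣ p (subst₂ ℕ._∣_ (ℕ.*-comm p (p ℕ.^ m)) (sym (ℕ.*-assoc D k p)) p^m+1∣Dn))

  affine-identity⇒res≡ : ∀ x z m → Affine (+ D) (0ℤ , plus , 0) x z m → res p x m ≡ res p z m
  affine-identity⇒res≡ x z m h = ∣-∧<⇒≡ (res<p^m x m) (res<p^m z m) (∣ᵤ⇒∣ (p^m∣D*n⇒p^m∣n m _
    (subst (p ℕ.^ m ℕ.∣_) (ℤ.abs-* (+ D) _) (∣⇒∣ᵤ (subst (pow m ∣_) factor h)))))
    where
    shape : ∀ D X Z → D * X - (D * (1ℤ * (1ℤ * Z)) + 0ℤ) ≡ D * (X - Z)
    shape = solve-∀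
    factor : defect (+ D) (0ℤ , plus , 0) x z m ≡ + D * (resℤ x m - resℤ z m)
    factor = trans (defect-normal (+ D) 0ℤ plus 0 x z m) (shape (+ D) (resℤ x m) (resℤ z m))

  affine-identity⇒digits≡ : ∀ x z m → Affine (+ D) (0ℤ , plus , 0) x z m → ∀ i → i < m → z i ≡ x i
  affine-identity⇒digits≡ x z m h i i<m = sym (res≡⇒digit≡ x z i
    (affine-identity⇒res≡ x z i (affine-≤ (+ D) (0ℤ , plus , 0) x z (ℕ.<⇒≤ i<m) h))
    (affine-identity⇒res≡ x z (suc i) (affine-≤ (+ D) (0ℤ , plus , 0) x z i<m h)))

fromFin2 : Fin 2 → Sign±
fromFin2 Fin.zero    = plus
fromFin2 (Fin.suc _) = minus

toFin2 : Sign± → Fin 2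
toFin2 plus  = Fin.zero
toFin2 minus = Fin.suc Fin.zero

fromFin2-toFin2 : ∀ σ → fromFin2 (toFin2 σ) ≡ σ
fromFin2-toFin2 plus  = refl
fromFin2-toFin2 minus = refl

decodeSigned : ∀ {n} → Fin (2 ℕ.* n) → Sign± × Fin n
decodeSigned {n} i = map₁ fromFin2 (Fin.remQuot n i)

encodeSigned : ∀ {n} → Sign± → Fin n → Fin (2 ℕ.* n)
encodeSigned σ a = Fin.combine (toFin2 σ) a

decodeSigned-encodeSigned : ∀ {n} σ (a : Fin n) → decodeSigned (encodeSigned σ a) ≡ (σ , a)
decodeSigned-encodeSigned {n} σ a = trans (cong (map₁ fromFin2) (Fin.remQuot-combine (toFin2 σ) a))
  (cong (_, a) (fromFin2-toFin2 σ))

module _ (M kmax : ℕ) where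

  Bounded : State → Set
  Bounded (A , σ , j) = ∣ A ∣ ≤ M × j ≤ kmax

  #codes : ℕ
  #codes = 2 ℕ.* suc M ℕ.* (2 ℕ.* suc kmax)

  assemble : (Sign± × Fin (suc M)) × (Sign± × Fin (suc kmax)) → State
  assemble ((σA , a) , (σ , j)) = applySign σA (+ toℕ a) , σ , toℕ j

  decode : Fin #codes → State
  decode v = assemble (map decodeSigned decodeSigned (Fin.remQuot (2 ℕ.* suc kmax) v))

  encode : ∀ v → Bounded v → Fin #codes
  encode (A , σ , j) (A≤M , j≤kmax) = Fin.combine
    (encodeSigned (signOf A) (Fin.fromℕ< (s≤s A≤M))) (encodeSigned σ (Fin.fromℕ< (s≤s j≤kmax)))

  decode-encode : ∀ v (bounded : Bounded v) → decode (encode v bounded) ≡ v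
  decode-encode (A , σ , j) (A≤M , j≤kmax) = begin
    assemble (map decodeSigned decodeSigned (Fin.remQuot (2 ℕ.* suc kmax) (Fin.combine a t)))
      ≡⟨ cong (λ q → assemble (map decodeSigned decodeSigned q)) (Fin.remQuot-combine a t) ⟩
    assemble (decodeSigned a , decodeSigned t)
      ≡⟨ cong₂ (λ a t → assemble (a , t)) (decodeSigned-encodeSigned (signOf A) _) (decodeSigned-encodeSigned σ _) ⟩
    applySign (signOf A) (+ toℕ (Fin.fromℕ< (s≤s A≤M))) , σ , toℕ (Fin.fromℕ< (s≤s j≤kmax))
      ≡⟨ cong₂ (λ a j → applySign (signOf A) (+ a) , σ , j) (Fin.toℕ-fromℕ< (s≤s A≤M)) (Fin.toℕ-fromℕ< (s≤s j≤kmax)) ⟩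
    applySign (signOf A) (+ ∣ A ∣) , σ , j
      ≡⟨ cong (_, σ , j) (applySign-signOf A) ⟩
    A , σ , j ∎
    where
    open ≡-Reasoning
    a = encodeSigned (signOf A) (Fin.fromℕ< (s≤s A≤M))
    t = encodeSigned σ (Fin.fromℕ< (s≤s j≤kmax))

module PathSetGraph {p : ℕ} (p-prime : Prime p) {n : ℕ}
  (s : Fin n → Sign±) (k : Fin n → ℕ) (b : Fin n → ℚ)
  (k≥1 : ∀ i → 1 ≤ k i) (b∈ℤₚ : ∀ i → IntegralAt p (b i)) where

  private instance
    p≢0 : NonZero p
    p≢0 = prime⇒nonZero p-prime

  d : Fin n → ℕ
  d i = ↧ₙ b i

  u : Fin n → ℤ
  u i = ↥ b i

  Dₙ : ℕ
  Dₙ = ∏ d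

  D : ℤ
  D = + Dₙ

  p⊥Dₙ : Coprime p Dₙ
  p⊥Dₙ = prime∤⇒coprime p-prime (prime∤∏ d p-prime b∈ℤₚ)

  p⊥d : ∀ i → Coprime p (d i)
  p⊥d i = prime∤⇒coprime p-prime (b∈ℤₚ i)

  c : Fin n → ℕ
  c i = ℕ.quotient (∣∏ d i)

  D≡c*d : ∀ i → D ≡ + c i * + d i
  D≡c*d i = trans (cong +_ (ℕ.m∣n⇒n≡quotient*m (∣∏ d i))) (ℤ.pos-* (c i) (d i))

  e : Fin n → ℤ
  e i = + c i * u i

  E : ℕ
  E = ∑ (λ i → ∣ e i ∣)

  M : ℕ
  M = Dₙ ℕ.+ E

  kmax : ℕ
  kmax = ∑ k

  Step : State → Fin p → State → Set
  Step (A , σ , suc j) δ v′ = Digit D (A , σ , suc j) δ v′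
  Step (A , σ , zero)  δ v′ = ∃ λ i → Digit D (A + sign σ * e i , σ *ˢ s i , k i) δ v′

  Step? : ∀ v δ v′ → Dec (Step v δ v′)
  Step? (A , σ , suc j) δ v′ = Digit? D (A , σ , suc j) δ v′
  Step? (A , σ , zero)  δ v′ = Fin.any? (λ i → Digit? D (A + sign σ * e i , σ *ˢ s i , k i) δ v′)

  Edge : Fin (#codes M kmax) → Fin p → Fin (#codes M kmax) → Bool
  Edge v δ v′ = does (Step? (decode M kmax v) δ (decode M kmax v′))

  v₀ : Fin (#codes M kmax)
  v₀ = encode M kmax (0ℤ , plus , 0) (z≤n , z≤n)

  shift-bound : ∀ {A} σ i → ∣ A ∣ ≤ M → ∣ A + sign σ * e i ∣ ≤ M ℕ.+ E
  shift-bound {A} σ i A≤M = ℕ.≤-trans (ℤ.∣i+j∣≤∣i∣+∣j∣ A (sign σ * e i)) (ℕ.+-mono-≤ A≤M (begin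
    ∣ sign σ * e i ∣         ≡⟨ ℤ.abs-* (sign σ) (e i) ⟩
    ∣ sign σ ∣ ℕ.* ∣ e i ∣   ≡⟨ cong (ℕ._* ∣ e i ∣) (∣sign∣≡1 σ) ⟩
    1 ℕ.* ∣ e i ∣            ≡⟨ ℕ.*-identityˡ ∣ e i ∣ ⟩
    ∣ e i ∣                  ≤⟨ ≤∑ (λ i → ∣ e i ∣) i ⟩
    E                        ∎))
    where open ℕ.≤-Reasoning

  module Attractor (K : Subset p) (nonempty : NonEmpty p K) (closed : IsClosed p K)
    (invariant : IsInvariant p n s k b K) where

    record Tracker (x : ℤ[ p ]) : Set where
      constructor tracker
      field
        state   : State
        bounded : Bounded M kmax state
        y       : ℤ[ p ]
        y∈K     : K y
        affine  : ∀ m → Affine D state x y m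
    open Tracker

    read-digit : ∀ {x} A σ l y → K y → (∀ m → Affine D (A , σ , l) x y m) →
      1 ≤ l → l ≤ kmax → ∣ A ∣ ≤ M ℕ.+ E → Σ (Tracker (tail x)) λ t → Digit D (A , σ , l) (x 0) (state t)
    read-digit {x} A σ (suc j) y y∈K h _ l≤kmax A≤ =
      tracker (A′ , σ , j) (A′≤M , ℕ.≤-trans (ℕ.n≤1+n j) l≤kmax) y y∈K
        (λ m → Equivalence.to (affine-digit D (A , σ , suc j) (A′ , σ , j) x y m step) (h (suc m))) , step
      where
      A′ : ℤ
      A′ = proj₁ (affine-first-digit D A σ j x y (h 1))
      step : Digit D (A , σ , suc j) (x 0) (A′ , σ , j)
      step = proj₂ (affine-first-digit D A σ j x y (h 1)) , refl , refl
      A′≤M : ∣ A′ ∣ ≤ M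
      A′≤M = quotient-bound {Dₙ = Dₙ} {E} {toℕ (x 0)} {A} {A′} (nonTrivial⇒n>1 p {{prime⇒nonTrivial p-prime}})
        (Fin.toℕ<n (x 0)) (proj₁ step) A≤

    advance : ∀ {x} (t : Tracker x) → Σ (Tracker (tail x)) λ t′ → Step (state t) (x 0) (state t′)
    advance (tracker (A , σ , suc j) (A≤M , j≤kmax) y y∈K h) =
      read-digit A σ (suc j) y y∈K h (s≤s z≤n) j≤kmax (ℕ.m≤n⇒m≤n+o E A≤M)
    advance {x} (tracker (A , σ , zero) (A≤M , _) y y∈K h) = proj₁ next , i , proj₂ next
      where
      preimage = proj₁ (invariant y) y∈K
      i = proj₁ preimage
      y′ = proj₁ (proj₂ preimage)
      h′ : ∀ m → Affine D (A + sign σ * e i , σ *ˢ s i , k i) x y′ m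
      h′ m = Equivalence.to (affine-compose (+ c i) (+ d i) A σ (u i) (s i) (k i) x y y′ m (D≡c*d i)
        (∣ᵤ⇒∣ (proj₂ (proj₂ (proj₂ preimage)) m))) (h m)
      next = read-digit (A + sign σ * e i) (σ *ˢ s i) (k i) y′ (proj₁ (proj₂ (proj₂ preimage))) h′
        (k≥1 i) (≤∑ k i) (shift-bound {A} σ i A≤M)

    vertex : ∀ {x} → Tracker x → Fin (#codes M kmax)
    vertex t = encode M kmax (state t) (bounded t)

    walk : ∀ x → Tracker x → ℕ → Fin (#codes M kmax)
    walk x t zero    = vertex t
    walk x t (suc i) = walk (tail x) (proj₁ (advance t)) i

    walk-edge : ∀ x t i → Edge (walk x t i) (x i) (walk x t (suc i)) ≡ true
    walk-edge x t zero = dec-true (Step? _ (x 0) _)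
      (subst₂ (λ v v′ → Step v (x 0) v′) (sym (decode-encode M kmax _ (bounded t)))
        (sym (decode-encode M kmax _ (bounded (proj₁ (advance t))))) (proj₂ (advance t)))
    walk-edge x t (suc i) = walk-edge (tail x) (proj₁ (advance t)) i

    start : ∀ x → K x → Tracker x
    start x x∈K = tracker (0ℤ , plus , 0) (z≤n , z≤n) x x∈K (affine-refl D x)

    ∈K⇒path : ∀ x → K x → ∃ λ (w : ℕ → Fin (#codes M kmax)) →
      w 0 ≡ v₀ × (∀ i → Edge (w i) (x i) (w (suc i)) ≡ true)
    ∈K⇒path x x∈K = walk x (start x x∈K) , refl , walk-edge x (start x x∈K)

    pullback : ∀ {v v′ x z′ m} → Step v (x 0) v′ → K z′ → Affine D v′ (tail x) z′ m →
      ∃ λ z → K z × Affine D v x z (suc m)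
    pullback {A , σ , suc j} {v′} {x} {z′} {m} step z′∈K h =
      z′ , z′∈K , Equivalence.from (affine-digit D _ v′ x z′ m step) h
    pullback {A , σ , zero} {v′} {x} {z′} {m} (i , step) z′∈K h = z , z∈K ,
      Equivalence.from (affine-compose (+ c i) (+ d i) A σ (u i) (s i) (k i) x z z′ (suc m) (D≡c*d i)
        (image-affine (p⊥d i) (u i , s i , k i) z′ (suc m)))
      (Equivalence.from (affine-digit D _ v′ x z′ m step) h)
      where
      z = image (p⊥d i) (u i , s i , k i) z′
      z∈K = proj₂ (invariant z) (i , z′ , z′∈K , λ m → ∣⇒∣ᵤ (image-affine (p⊥d i) (u i , s i , k i) z′ m))

    approximate : ∀ (vs : ℕ → State) x → (∀ i → Step (vs i) (x i) (vs (suc i))) →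
      ∀ m → ∃ λ z → K z × Affine D (vs 0) x z m
    approximate vs x steps zero = proj₁ nonempty , proj₂ nonempty , affine-zero D (vs 0) x (proj₁ nonempty)
    approximate vs x steps (suc m) with approximate (λ i → vs (suc i)) (tail x) (λ i → steps (suc i)) m
    ... | z′ , z′∈K , h = pullback (steps 0) z′∈K h

    path⇒∈K : ∀ x (w : ℕ → Fin (#codes M kmax)) → w 0 ≡ v₀ →
      (∀ i → Edge (w i) (x i) (w (suc i)) ≡ true) → K x
    path⇒∈K x w w₀≡v₀ edges = closed x λ m → close m (approximate (λ i → decode M kmax (w i)) x
      (λ i → does≡true⇒ (Step? (decode M kmax (w i)) (x i) (decode M kmax (w (suc i)))) (edges i)) m)
      where
      decode-w₀ : decode M kmax (w 0) ≡ (0ℤ , plus , 0)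
      decode-w₀ = trans (cong (decode M kmax) w₀≡v₀) (decode-encode M kmax _ (z≤n , z≤n))
      close : ∀ m → (∃ λ z → K z × Affine D (decode M kmax (w 0)) x z m) → ∃ λ z → K z × (∀ i → i < m → z i ≡ x i)
      close m (z , z∈K , h) = z , z∈K ,
        affine-identity⇒digits≡ p⊥Dₙ x z m (subst (λ v → Affine D v x z m) decode-w₀ h)

corollary3p4 : (p : ℕ) → Prime p → (n : ℕ) →
    (s : Fin n → Sign±) (k : Fin n → ℕ) (b : Fin n → ℚ) →
    (∀ i → 1 ≤ k i) → (∀ i → IntegralAt p (b i)) →
    (K : Subset p) → NonEmpty p K → IsClosed p K → IsInvariant p n s k b K →
    IsPathSet p K
corollary3p4 p p-prime n s k b k≥1 b∈ℤₚ K nonempty closed invariant =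
  #codes M kmax , Edge , v₀ , λ x → ∈K⇒path x , λ { (w , w₀≡v₀ , edges) → path⇒∈K x w w₀≡v₀ edges }
  where
  open PathSetGraph p-prime s k b k≥1 b∈ℤₚ
  open Attractor K nonempty closed invariant
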